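{- Let $Q$ be a quiver with mutable and frozen vertices. Let $A$ and $B$ be mutable vertices of $Q$ such that between $A$ and $B$ there is exactly one arrow, directed from $B$ to $A$, and suppose that every arrow between $A$ and a frozen vertex is directed from $A$ to the frozen vertex. Let $\widehat Q$ be the quiver obtained by mutating $Q$ at $A$. Then $\operatorname{fc}_{\widehat Q}(A)=1/\operatorname{fc}_Q(A)$ and $\operatorname{fc}_{\widehat Q}(B)=\operatorname{fc}_Q(A)\cdot\operatorname{fc}_Q(B)$.
   Context: Quivers have no loops or 2-cycles. Mutation at a mutable vertex $A$: for each path $X\to A\to Y$ add an arrow $X\to Y$, reverse all arrows incident to $A$, then remove a maximal collection of 2-cycles (arrows between two frozen vertices are disregarded). If $f_1,\dots,f_n$ are the frozen vertices (treated as formal variables) and $v$ is a mutable vertex, let $m_i$ be the number of arrows $v\to f_i$ minus the number of arrows $f_i\to v$; the frozen coefficient is the Laurent monomial $\operatorname{fc}_Q(v)=\prod_{i=1}^n f_i^{m_i}$. -}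

module Defs where

open import Data.Nat using (ℕ; zero; suc; _+_; _*_; _∸_)
open import Data.Integer using (ℤ; +_; _-_; 0ℤ)
open import Data.Fin using (Fin; _≟_)
open import Data.Bool using (Bool; true; false; _∧_; _∨_; if_then_else_)
open import Data.Sum using (_⊎_)
open import Relation.Binary.PropositionalEquality using (_≡_)
open import Relation.Nullary.Decidable using (⌊_⌋)

record Quiver (n : ℕ) : Set where
  field
    isFrozen  : Fin n → Bool
    arrows    : Fin n → Fin n → ℕ
    noLoops   : ∀ v → arrows v v ≡ 0
    no2Cycles : ∀ u v → arrows u v ≡ 0 ⊎ arrows v u ≡ 0

open Quiver public

Mutable : ∀ {n} → Quiver n → Fin n → Set
Mutable Q v = isFrozen Q v ≡ false

Frozen : ∀ {n} → Quiver n → Fin n → Set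
Frozen Q v = isFrozen Q v ≡ true

-- Arrow counts after mutation at A (before proving it is again a quiver):
--  * arrows incident to A are reversed;
--  * for other X, Y, every path X → A → Y contributes an arrow X → Y;
--  * then a maximal collection of 2-cycles is removed (net count kept);
--  * arrows between two frozen vertices are disregarded (dropped).
mutArrows : ∀ {n} → Quiver n → Fin n → Fin n → Fin n → ℕ
mutArrows Q A X Y =
  if ⌊ X ≟ A ⌋ ∨ ⌊ Y ≟ A ⌋ then arrows Q Y X
  else (if isFrozen Q X ∧ isFrozen Q Y then 0
  else (c ∸ c'))
  where
  c  = arrows Q X Y + arrows Q X A * arrows Q A Y
  c' = arrows Q Y X + arrows Q Y A * arrows Q A X

-- Frozen coefficient fc_Q(v), a Laurent monomial in the frozen variables,
-- represented by its exponent vector: the exponent of f (f frozen) is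
-- #(v → f) − #(f → v); the exponent at mutable vertices is 0.
-- Multiplication of monomials = pointwise addition of exponent vectors,
-- 1/m = pointwise negation, and the monomial 1 = the zero vector.
fcGen : ∀ {n} → (Fin n → Bool) → (Fin n → Fin n → ℕ) → Fin n → Fin n → ℤ
fcGen fr arr v f = if fr f then (+ arr v f) - (+ arr f v) else 0ℤ

fc : ∀ {n} → Quiver n → Fin n → Fin n → ℤ
fc Q = fcGen (isFrozen Q) (arrows Q)

fcMut : ∀ {n} → Quiver n → Fin n → Fin n → Fin n → ℤ
fcMut Q A = fcGen (isFrozen Q) (mutArrows Q A)

-- Mutation at A reverses the arrows at A, so the exponents of fc(A) change sign.
-- Between B and a frozen f, mutation preserves the net number of arrows after
-- adding one arrow B → f for every path B → A → f; since A has exactly one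
-- incoming arrow from B and no incoming arrows from frozen vertices, this adds
-- exactly the exponents of fc(A) to those of fc(B).
module Submission where

open import Defs
open import Data.Nat using (ℕ; suc; _∸_) renaming (_+_ to _+ℕ_; _*_ to _*ℕ_)
import Data.Nat.Properties as ℕ
open import Data.Integer using (ℤ; _+_; _-_; -_; +_; _⊖_)
open import Data.Integer.Properties
  using (m-n≡m⊖n; ⊖-swap; [1+m]⊖[1+n]≡m⊖n; pos-+; +-assoc; +-comm; +-identityʳ)
open import Data.Fin using (Fin; _≟_)
open import Data.Bool using (true; false; _∧_)
open import Data.Bool.Properties using (∧-comm)
open import Data.Product using (_×_; _,_)
open import Data.Sum using (_⊎_; inj₁; inj₂)
open import Relation.Nullary using (yes; no; contradiction)
open import Relation.Binary.PropositionalEquality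

m∸n⊖n∸m≡m⊖n : ∀ m n → (m ∸ n) ⊖ (n ∸ m) ≡ m ⊖ n
m∸n⊖n∸m≡m⊖n 0       0       = refl
m∸n⊖n∸m≡m⊖n 0       (suc n) = refl
m∸n⊖n∸m≡m⊖n (suc m) 0       = refl
m∸n⊖n∸m≡m⊖n (suc m) (suc n) = trans (m∸n⊖n∸m≡m⊖n m n) (sym ([1+m]⊖[1+n]≡m⊖n m n))

+[m∸n]-+[n∸m]≡+m-+n : ∀ m n → + (m ∸ n) - + (n ∸ m) ≡ + m - + n
+[m∸n]-+[n∸m]≡+m-+n m n = begin
  + (m ∸ n) - + (n ∸ m) ≡⟨ m-n≡m⊖n (m ∸ n) (n ∸ m) ⟩
  (m ∸ n) ⊖ (n ∸ m)     ≡⟨ m∸n⊖n∸m≡m⊖n m n ⟩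
  m ⊖ n                 ≡⟨ m-n≡m⊖n m n ⟨
  + m - + n             ∎
  where open ≡-Reasoning

+[m+n]-+o≡+n+[+m-+o] : ∀ m n o → + (m +ℕ n) - + o ≡ + n + (+ m - + o)
+[m+n]-+o≡+n+[+m-+o] m n o = begin
  + (m +ℕ n) - + o  ≡⟨ cong (_- + o) (trans (pos-+ m n) (+-comm (+ m) (+ n))) ⟩
  + n + + m - + o   ≡⟨ +-assoc (+ n) (+ m) (- + o) ⟩
  + n + (+ m - + o) ∎
  where open ≡-Reasoning

module _ {n : ℕ} where

  net : (Fin n → Fin n → ℕ) → Fin n → Fin n → ℤ
  net arr X Y = + arr X Y - + arr Y X

  net-antisym : ∀ arr X Y → net arr X Y ≡ - net arr Y X
  net-antisym arr X Y = begin
    + arr X Y - + arr Y X   ≡⟨ m-n≡m⊖n (arr X Y) (arr Y X) ⟩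
    arr X Y ⊖ arr Y X       ≡⟨ ⊖-swap (arr X Y) (arr Y X) ⟩
    - (arr Y X ⊖ arr X Y)   ≡⟨ cong -_ (m-n≡m⊖n (arr Y X) (arr X Y)) ⟨
    - (+ arr Y X - + arr X Y) ∎
    where open ≡-Reasoning

  composedArrows : Quiver n → Fin n → Fin n → Fin n → ℕ
  composedArrows Q A X Y = arrows Q X Y +ℕ arrows Q X A *ℕ arrows Q A Y

  module _ (Q : Quiver n) where

    frozen-or-mutable : ∀ v → Frozen Q v ⊎ Mutable Q v
    frozen-or-mutable v with isFrozen Q v
    ... | true  = inj₁ refl
    ... | false = inj₂ refl

    fcGen-frozen : ∀ {f} → Frozen Q f → ∀ arr v → fcGen (isFrozen Q) arr v f ≡ net arr v f
    fcGen-frozen frozen arr v rewrite frozen = refl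

    arrow⇒≢ : ∀ {X Y m} → arrows Q X Y ≡ suc m → X ≢ Y
    arrow⇒≢ {X} {Y} X→Y refl = ℕ.0≢1+n (trans (sym (noLoops Q X)) X→Y)

    frozen⇒≢mutable : ∀ {f v} → Frozen Q f → Mutable Q v → f ≢ v
    frozen⇒≢mutable frozen mutable refl with () ← trans (sym frozen) mutable

    mutArrows-from : ∀ A Y → mutArrows Q A A Y ≡ arrows Q Y A
    mutArrows-from A Y with A ≟ A
    ... | yes _  = refl
    ... | no A≢A = contradiction refl A≢A

    mutArrows-to : ∀ A X → mutArrows Q A X A ≡ arrows Q A X
    mutArrows-to A X with X ≟ A | A ≟ A
    ... | yes _ | _      = refl
    ... | no _  | yes _  = refl
    ... | no _  | no A≢A = contradiction refl A≢A

    mutArrows-away : ∀ {A X Y} → X ≢ A → Y ≢ A → (isFrozen Q X ∧ isFrozen Q Y) ≡ false →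
      mutArrows Q A X Y ≡ composedArrows Q A X Y ∸ composedArrows Q A Y X
    mutArrows-away {A} {X} {Y} X≢A Y≢A notBothFrozen with X ≟ A | Y ≟ A
    ... | yes X≡A | _       = contradiction X≡A X≢A
    ... | no _    | yes Y≡A = contradiction Y≡A Y≢A
    ... | no _    | no _    rewrite notBothFrozen = refl

    -- Removing 2-cycles does not change the net number of arrows.
    net-mutArrows-away : ∀ {A X Y} → X ≢ A → Y ≢ A → (isFrozen Q X ∧ isFrozen Q Y) ≡ false →
      net (mutArrows Q A) X Y ≡ + composedArrows Q A X Y - + composedArrows Q A Y X
    net-mutArrows-away {A} {X} {Y} X≢A Y≢A notBothFrozen = begin
      + mutArrows Q A X Y - + mutArrows Q A Y X
        ≡⟨ cong₂ (λ p q → + p - + q)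
                 (mutArrows-away X≢A Y≢A notBothFrozen)
                 (mutArrows-away Y≢A X≢A (trans (∧-comm (isFrozen Q Y) (isFrozen Q X)) notBothFrozen)) ⟩
      + (c ∸ c′) - + (c′ ∸ c)
        ≡⟨ +[m∸n]-+[n∸m]≡+m-+n c c′ ⟩
      + c - + c′ ∎
      where
      open ≡-Reasoning
      c  = composedArrows Q A X Y
      c′ = composedArrows Q A Y X


    net-mutArrows-through : ∀ {A X Y} → X ≢ A → Y ≢ A → (isFrozen Q X ∧ isFrozen Q Y) ≡ false →
      arrows Q X A ≡ 1 → arrows Q Y A ≡ 0 →
      net (mutArrows Q A) X Y ≡ net (arrows Q) A Y + net (arrows Q) X Y
    net-mutArrows-through {A} {X} {Y} X≢A Y≢A notBothFrozen X→A Y↛A = begin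
      net (mutArrows Q A) X Y
        ≡⟨ net-mutArrows-away X≢A Y≢A notBothFrozen ⟩
      + composedArrows Q A X Y - + composedArrows Q A Y X
        ≡⟨ cong₂ (λ p q → + p - + q) composed-X→Y composed-Y→X ⟩
      + (arrows Q X Y +ℕ arrows Q A Y) - + arrows Q Y X
        ≡⟨ +[m+n]-+o≡+n+[+m-+o] (arrows Q X Y) (arrows Q A Y) (arrows Q Y X) ⟩
      + arrows Q A Y + net (arrows Q) X Y
        ≡⟨ cong (_+ net (arrows Q) X Y) net-A→Y ⟨
      net (arrows Q) A Y + net (arrows Q) X Y ∎
      where
      open ≡-Reasoning

      composed-X→Y : composedArrows Q A X Y ≡ arrows Q X Y +ℕ arrows Q A Y
      composed-X→Y = trans (cong (λ k → arrows Q X Y +ℕ k *ℕ arrows Q A Y) X→A)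
                           (cong (arrows Q X Y +ℕ_) (ℕ.*-identityˡ (arrows Q A Y)))

      composed-Y→X : composedArrows Q A Y X ≡ arrows Q Y X
      composed-Y→X = trans (cong (λ k → arrows Q Y X +ℕ k *ℕ arrows Q A X) Y↛A)
                           (ℕ.+-identityʳ (arrows Q Y X))

      net-A→Y : net (arrows Q) A Y ≡ + arrows Q A Y
      net-A→Y = trans (cong (λ k → + arrows Q A Y - + k) Y↛A) (+-identityʳ (+ arrows Q A Y))

lemma9p3 : ∀ {n} (Q : Quiver n) (A B : Fin n) →
    Mutable Q A → Mutable Q B →
    arrows Q B A ≡ 1 → arrows Q A B ≡ 0 →
    (∀ f → Frozen Q f → arrows Q f A ≡ 0) →
    (∀ f → fcMut Q A A f ≡ - fc Q A f) × (∀ f → fcMut Q A B f ≡ fc Q A f + fc Q B f)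
-- The hypothesis arrows Q A B ≡ 0 already follows from arrows Q B A ≡ 1 and no2Cycles.
lemma9p3 Q A B A-mutable B-mutable B→A _ frozen↛A = fcMut-A , fcMut-B
  where
  open ≡-Reasoning

  fcMut-A : ∀ f → fcMut Q A A f ≡ - fc Q A f
  fcMut-A f with frozen-or-mutable Q f
  ... | inj₂ mutable rewrite mutable = refl
  ... | inj₁ frozen = begin
    fcMut Q A A f           ≡⟨ fcGen-frozen Q frozen (mutArrows Q A) A ⟩
    net (mutArrows Q A) A f ≡⟨ cong₂ (λ p q → + p - + q) (mutArrows-from Q A f) (mutArrows-to Q A f) ⟩
    net (arrows Q) f A      ≡⟨ net-antisym (arrows Q) f A ⟩
    - net (arrows Q) A f    ≡⟨ cong -_ (fcGen-frozen Q frozen (arrows Q) A) ⟨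
    - fc Q A f              ∎

  fcMut-B : ∀ f → fcMut Q A B f ≡ fc Q A f + fc Q B f
  fcMut-B f with frozen-or-mutable Q f
  ... | inj₂ mutable rewrite mutable = refl
  ... | inj₁ frozen = begin
    fcMut Q A B f
      ≡⟨ fcGen-frozen Q frozen (mutArrows Q A) B ⟩
    net (mutArrows Q A) B f
      ≡⟨ net-mutArrows-through Q (arrow⇒≢ Q B→A) (frozen⇒≢mutable Q frozen A-mutable)
                                 (cong (_∧ isFrozen Q f) B-mutable) B→A (frozen↛A f frozen) ⟩
    net (arrows Q) A f + net (arrows Q) B f
      ≡⟨ cong₂ _+_ (fcGen-frozen Q frozen (arrows Q) A) (fcGen-frozen Q frozen (arrows Q) B) ⟨
    fc Q A f + fc Q B f ∎
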